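{- Let $\mathcal A$ be a nonzero commutative unital $\mathbb Q$-algebra. Let $\mathfrak t_{\mathcal A}$ be the Lie algebra of the transfer group $T_{\mathcal A}$, namely the space of $\mathcal A$-valued infinitesimal characters of the Hopf algebra $\mathcal H/\mathcal N$, i.e. linear maps $\xi:\mathcal H/\mathcal N\to\mathcal A$ with $\xi(xy)=\xi(x)\bar\varepsilon(y)+\bar\varepsilon(x)\xi(y)$ for all $x,y$ (where $\bar\varepsilon$ is the induced counit). Then $\mathfrak t_{\mathcal A}$ is infinite-dimensional.
   Context: $Y=\{z_k:k\in\mathbb Z\}$, and $\mathcal H=\langle Y\rangle_{\mathbb Q}$ is the $\mathbb Q$-vector space spanned by words in $Y$ (empty word $\mathbf 1$), equipped with the quasi-shuffle product $\ast$ defined by $\mathbf 1\ast w=w\ast\mathbf 1=w$ and $z_mu\ast z_nv=z_m(u\ast z_nv)+z_n(z_mu\ast v)+z_{m+n}(u\ast v)$; deconcatenation coproduct $\Delta(w)=\sum_{uv=w}u\otimes v$; counit $\varepsilon(\mathbf 1)=1$, $\varepsilon(w)=0$ for nonempty $w$; this is a Hopf algebra. A word $z_{k_1}\cdots z_{k_n}$ ($n\ge1$) is non-singular if $k_1\neq1$, $k_1+k_2\notin\{2,1,0,-2,-4,\ldots\}$ (when $n\ge2$), and $k_1+\cdots+k_j\notin\mathbb Z_{\le j}$ for all $3\le j\le n$; $N$ is the $\mathbb Q$-span of non-singular words, and $\mathcal N$ is the two-sided ideal of $(\mathcal H,\ast)$ generated by $N$, which is a Hopf ideal. The transfer group $T_{\mathcal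 A}$ is the group (under convolution $\phi\star\psi=m_{\mathcal A}\circ(\phi\otimes\psi)\circ\Delta$) of unital algebra morphisms $\phi:(\mathcal H,\ast)\to\mathcal A$ with $\phi|_N=0$, equivalently the group of $\mathcal A$-valued characters of $\mathcal H/\mathcal N$. Infinite-dimensional means infinite-dimensional as a $\mathbb Q$-vector space. -}

module Defs where

open import Level using (Level; _⊔_; suc)
open import Data.Nat as ℕ using (ℕ)
open import Data.Integer as ℤ using (ℤ; +_)
open import Data.Rational as ℚ using (ℚ)
import Data.Rational.Properties as ℚP
open import Data.List using (List; []; _∷_; map; _++_; concatMap; foldr)
open import Data.Product using (Σ; _×_; _,_; proj₁; ∃-syntax)
open import Data.Sum using (_⊎_)
open import Data.Unit using (⊤)
open import Data.Empty using (⊥)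
open import Data.Fin using (Fin)
open import Relation.Nullary using (¬_)
open import Relation.Binary.PropositionalEquality using (_≡_; _≢_)
open import Algebra.Bundles using (CommutativeRing)
open import Algebra.Morphism.Structures using (module RingMorphisms)

-- Words over the alphabet Y = { z_k : k ∈ ℤ }; the word z_{k1}…z_{kn}
-- is the list k1 ∷ … ∷ kn ∷ [], the empty word 𝟏 is [].

Word : Set
Word = List ℤ

-- Quasi-shuffle product of two words, as the list of words (with
-- multiplicity) occurring in the sum u ∗ v (all coefficients are 1).
qsh : Word → Word → List Word
qsh [] v = v ∷ []
qsh (m ∷ u) [] = (m ∷ u) ∷ []
qsh (m ∷ u) (n ∷ v) =
  map (m ∷_) (qsh u (n ∷ v)) ++
  map (n ∷_) (qsh (m ∷ u) v) ++
  map ((m ℤ.+ n) ∷_) (qsh u v)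

-- The Q-vector space H: elements are finite formal ℚ-linear
-- combinations Σ q_i w_i, represented as lists of (q_i , w_i).

H : Set
H = List (ℚ × Word)

word : Word → H
word w = (ℚ.1ℚ , w) ∷ []

_∗_ : H → H → H
x ∗ y = concatMap (λ { (p , u) →
          concatMap (λ { (q , v) → map (λ w → (p ℚ.* q , w)) (qsh u v) }) y }) x

εw : Word → ℚ
εw [] = ℚ.1ℚ
εw (_ ∷ _) = ℚ.0ℚ

ε : H → ℚ
ε = foldr (λ { (q , w) r → q ℚ.* εw w ℚ.+ r }) ℚ.0ℚ

Bad₂ : ℤ → Set
Bad₂ t = t ≡ + 2 ⊎ t ≡ + 1 ⊎ (∃[ k ] t ≡ ℤ.- (+ (2 ℕ.* k)))

-- condition k1+…+kj ∉ ℤ_{≤ j} for j ≥ 3; s is the partial sum so far,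
-- j the index of the next letter
condTail : ℕ → ℤ → Word → Set
condTail j s [] = ⊤
condTail j s (k ∷ ks) = (+ j ℤ.< s ℤ.+ k) × condTail (ℕ.suc j) (s ℤ.+ k) ks

cond₂ : ℤ → Word → Set
cond₂ s [] = ⊤
cond₂ s (k ∷ ks) = ¬ Bad₂ (s ℤ.+ k) × condTail 3 (s ℤ.+ k) ks

NonSingular : Word → Set
NonSingular [] = ⊥
NonSingular (k ∷ ks) = k ≢ + 1 × cond₂ k ks

-- Elements of the ideal 𝒩 of (H,∗) generated by N: since (H,∗) is
-- commutative and N is spanned by the non-singular words, every element
-- of 𝒩 is a finite sum Σ_i n_i ∗ h_i with n_i non-singular words, h_i ∈ H.
IdealGen : Set
IdealGen = List (Σ Word NonSingular × H)

idealElem : IdealGen → H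
idealElem = concatMap (λ { ((n , _) , h) → word n ∗ h })

record QAlgebra (c ℓ : Level) : Set (suc (c ⊔ ℓ)) where
  field
    cring : CommutativeRing c ℓ
  open CommutativeRing cring public
  field
    ι    : ℚ → Carrier
    ι-hom : RingMorphisms.IsRingHomomorphism
              (CommutativeRing.rawRing ℚP.+-*-commutativeRing) rawRing ι

module _ {c ℓ : Level} (𝒜 : QAlgebra c ℓ) where
  open QAlgebra 𝒜

  -- a ℚ-linear map H → A is determined by its values on words;
  -- this is its linear extension
  linExt : (Word → Carrier) → H → Carrier
  linExt ξ = foldr (λ { (q , w) r → ι q * ξ w + r }) 0#

  -- ξ (viewed as a linear map on H) vanishes on the ideal 𝒩, i.e.
  -- it descends to a linear map H/𝒩 → A
  VanishesOn𝒩 : (Word → Carrier) → Set ℓ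
  VanishesOn𝒩 ξ = ∀ (g : IdealGen) → linExt ξ (idealElem g) ≈ 0#

  IsInfChar : (Word → Carrier) → Set ℓ
  IsInfChar ξ = ∀ (x y : H) →
    linExt ξ (x ∗ y) ≈ linExt ξ x * ι (ε y) + ι (ε x) * linExt ξ y

  In𝔱 : (Word → Carrier) → Set ℓ
  In𝔱 ξ = VanishesOn𝒩 ξ × IsInfChar ξ

  linComb : (n : ℕ) → (Fin n → ℚ) → (Fin n → Word → Carrier) → Word → Carrier
  linComb ℕ.zero cs ξs w = 0#
  linComb (ℕ.suc n) cs ξs w =
    ι (cs Fin.zero) * ξs Fin.zero w + linComb n (λ i → cs (Fin.suc i)) (λ i → ξs (Fin.suc i)) w
    where import Data.Fin as Fin

  LinIndep : (n : ℕ) → (Fin n → Word → Carrier) → Set ℓ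
  LinIndep n ξs = ∀ (cs : Fin n → ℚ) →
    (∀ w → linComb n cs ξs w ≈ 0#) → ∀ i → cs i ≡ ℚ.0ℚ

  𝔱-InfiniteDimensional : Set (c ⊔ ℓ)
  𝔱-InfiniteDimensional = ∀ (n : ℕ) →
    Σ (Fin n → Word → Carrier) λ ξs → (∀ i → In𝔱 (ξs i)) × LinIndep n ξs

  Nonzero : Set ℓ
  Nonzero = ¬ (1# ≈ 0#)

{-# OPTIONS --safe #-}
-- Since deconcatenation is multiplicative for the quasi-shuffle product, the convolution
-- commutator of two infinitesimal characters is again one. The map ζ (z_k w) = k (-1)^|w| is an
-- infinitesimal character, and so is each homogeneous component ζ_c of it for the weight
-- k₁ + ⋯ + kₙ, which ∗ preserves. Hence η_a = [ζ_a, ζ_{1-a}] is an infinitesimal character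
-- supported on words of weight 1. No non-singular word has weight 1, so η_a vanishes on N and
-- therefore on the ideal 𝒩. On the words τ_s = z_{s+2} z_{-(s+1)} of weight 1, η_{t+2} (τ_s)
-- vanishes for s ≠ t and equals -(t+2)(t+1) for s = t, so the η_{t+2} are linearly independent;
-- this survives composition with ℚ → 𝒜, which is injective because 𝒜 ≠ 0.
module Submission where

open import Defs
open import Level using (Level)
open import Function using (_∘_; flip)
open import Data.Nat as ℕ using (ℕ; zero; suc)
open import Data.Fin as Fin using (Fin; toℕ)
import Data.Fin.Properties as FinP
import Data.Nat.Properties as ℕP
open import Data.Integer as ℤ using (ℤ; +_; -[1+_]; +<+)
import Data.Integer.Properties as ℤP
import Data.Integer.Tactic.RingSolver as ℤSolver
open import Data.Rational as ℚ using (ℚ; 0ℚ; 1ℚ; _+_; _*_; -_; _-_)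
import Data.Rational.Properties as ℚP
import Data.Rational.Unnormalised as ℚᵘ
import Data.Rational.Unnormalised.Properties as ℚᵘP
open import Data.Rational.Solver using (module +-*-Solver)
open import Data.List using (List; []; _∷_; map; _++_; concatMap)
open import Data.Product using (_×_; _,_; proj₁; proj₂; map₁)
open import Data.Sum using (inj₁; inj₂)
open import Relation.Binary.PropositionalEquality
  using (_≡_; _≢_; refl; sym; trans; cong; cong₂; subst; module ≡-Reasoning)
open import Relation.Nullary using (yes; no; contradiction)
open import Relation.Nullary.Decidable using (decidable-stable)
open import Algebra.Apartness.Properties.HeytingCommutativeRing ℚP.heytingCommutativeRing
  using (x#0y#0→xy#0)
open import Algebra.Morphism.Structures using (module RingMorphisms)
open import Algebra.Bundles using (CommutativeMonoid)
open import Algebra.Properties.CommutativeSemigroup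
  (CommutativeMonoid.commutativeSemigroup ℚP.+-0-commutativeMonoid) using (interchange)
open import Algebra.Properties.CommutativeSemigroup
  (CommutativeMonoid.commutativeSemigroup ℚP.*-1-commutativeMonoid) using (x∙yz≈y∙xz)
open +-*-Solver using (solve; _:+_; _:*_; _:-_; :-_; con; _:=_)

private
  variable
    A B : Set

fromℤ : ℤ → ℚ
fromℤ k = k ℚ./ 1

fromℤ-toℚᵘ : ∀ k → ℚ.toℚᵘ (fromℤ k) ℚᵘ.≃ ℚᵘ.mkℚᵘ k 0
fromℤ-toℚᵘ k = ℚP.toℚᵘ-fromℚᵘ (ℚᵘ.mkℚᵘ k 0)

fromℤ-+ : ∀ m n → fromℤ (m ℤ.+ n) ≡ fromℤ m + fromℤ n
fromℤ-+ m n = ℚP.toℚᵘ-injective (begin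
  ℚ.toℚᵘ (fromℤ (m ℤ.+ n))                ≈⟨ fromℤ-toℚᵘ (m ℤ.+ n) ⟩
  ℚᵘ.mkℚᵘ (m ℤ.+ n) 0                     ≈⟨ ℚᵘ.*≡* (denominators-one m n) ⟩
  ℚᵘ.mkℚᵘ m 0 ℚᵘ.+ ℚᵘ.mkℚᵘ n 0            ≈⟨ ℚᵘP.+-cong (fromℤ-toℚᵘ m) (fromℤ-toℚᵘ n) ⟨
  ℚ.toℚᵘ (fromℤ m) ℚᵘ.+ ℚ.toℚᵘ (fromℤ n)  ≈⟨ ℚP.toℚᵘ-homo-+ (fromℤ m) (fromℤ n) ⟨
  ℚ.toℚᵘ (fromℤ m + fromℤ n)              ∎)
  where
  open ℚᵘP.≃-Reasoning
  denominators-one : ∀ m n → (m ℤ.+ n) ℤ.* + 1 ≡ (m ℤ.* + 1 ℤ.+ n ℤ.* + 1) ℤ.* + 1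
  denominators-one = ℤSolver.solve-∀

fromℤ≡0⇒≡0 : ∀ k → fromℤ k ≡ 0ℚ → k ≡ + 0
fromℤ≡0⇒≡0 k eq
  with ℚᵘP.≃-trans (ℚᵘP.≃-sym (fromℤ-toℚᵘ k)) (ℚᵘP.≃-reflexive (cong ℚ.toℚᵘ eq))
... | ℚᵘ.*≡* k*1≡0*1 = trans (sym (ℤP.*-identityʳ k)) k*1≡0*1

∑ : List A → (A → ℚ) → ℚ
∑ []       F = 0ℚ
∑ (x ∷ xs) F = F x + ∑ xs F

∑-++ : ∀ (xs ys : List A) F → ∑ (xs ++ ys) F ≡ ∑ xs F + ∑ ys F
∑-++ []       ys F = sym (ℚP.+-identityˡ (∑ ys F))
∑-++ (x ∷ xs) ys F = trans (cong (_+_ (F x)) (∑-++ xs ys F)) (sym (ℚP.+-assoc (F x) _ _))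

∑-map : ∀ (f : A → B) xs F → ∑ (map f xs) F ≡ ∑ xs (F ∘ f)
∑-map f []       F = refl
∑-map f (x ∷ xs) F = cong (_+_ (F (f x))) (∑-map f xs F)

∑-cong : ∀ (xs : List A) {F G} → (∀ x → F x ≡ G x) → ∑ xs F ≡ ∑ xs G
∑-cong []       F≗G = refl
∑-cong (x ∷ xs) F≗G = cong₂ _+_ (F≗G x) (∑-cong xs F≗G)

∑-+ : ∀ (xs : List A) F G → ∑ xs (λ x → F x + G x) ≡ ∑ xs F + ∑ xs G
∑-+ []       F G = refl
∑-+ (x ∷ xs) F G = trans (cong (_+_ (F x + G x)) (∑-+ xs F G)) (interchange (F x) (G x) _ _)

∑-*ˡ : ∀ (xs : List A) c F → ∑ xs (λ x → c * F x) ≡ c * ∑ xs F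
∑-*ˡ []       c F = sym (ℚP.*-zeroʳ c)
∑-*ˡ (x ∷ xs) c F = trans (cong (_+_ (c * F x)) (∑-*ˡ xs c F)) (sym (ℚP.*-distribˡ-+ c (F x) _))

∑-*ʳ : ∀ (xs : List A) c F → ∑ xs (λ x → F x * c) ≡ ∑ xs F * c
∑-*ʳ []       c F = sym (ℚP.*-zeroˡ c)
∑-*ʳ (x ∷ xs) c F = trans (cong (_+_ (F x * c)) (∑-*ʳ xs c F)) (sym (ℚP.*-distribʳ-+ c (F x) _))

∑-neg : ∀ (xs : List A) F → ∑ xs (λ x → - F x) ≡ - ∑ xs F
∑-neg []       F = refl
∑-neg (x ∷ xs) F = trans (cong (_+_ (- F x)) (∑-neg xs F)) (sym (ℚP.neg-distrib-+ (F x) _))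

∑-zero : ∀ (xs : List A) → ∑ xs (λ _ → 0ℚ) ≡ 0ℚ
∑-zero []       = refl
∑-zero (x ∷ xs) = trans (ℚP.+-identityˡ _) (∑-zero xs)

∑-+₃ : ∀ (xs : List A) F G H →
  ∑ xs (λ x → F x + (G x + H x)) ≡ ∑ xs F + (∑ xs G + ∑ xs H)
∑-+₃ xs F G H = trans (∑-+ xs F _) (cong (_+_ (∑ xs F)) (∑-+ xs G H))

∑∑-* : ∀ (xs : List A) (ys : List B) F G →
  ∑ xs (λ x → ∑ ys (λ y → F x * G y)) ≡ ∑ xs F * ∑ ys G
∑∑-* xs ys F G = trans (∑-cong xs (λ x → ∑-*ˡ ys (F x) G)) (∑-*ʳ xs (∑ ys G) F)

∑∑-+ : ∀ (xs : List A) (ys : List B) (F G : A → B → ℚ) →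
  ∑ xs (λ x → ∑ ys (λ y → F x y + G x y)) ≡
  ∑ xs (λ x → ∑ ys (λ y → F x y)) + ∑ xs (λ x → ∑ ys (λ y → G x y))
∑∑-+ xs ys F G =
  trans (∑-cong xs (λ x → ∑-+ ys (F x) (G x))) (∑-+ xs (λ x → ∑ ys (F x)) (λ x → ∑ ys (G x)))

∑-concatMap : ∀ (G : A → List B) xs F → ∑ (concatMap G xs) F ≡ ∑ xs (λ x → ∑ (G x) F)
∑-concatMap G []       F = refl
∑-concatMap G (x ∷ xs) F =
  trans (∑-++ (G x) (concatMap G xs) F) (cong (_+_ (∑ (G x) F)) (∑-concatMap G xs F))

infix 8 _⟦_∗_⟧

_⟦_∗_⟧ : (Word → ℚ) → Word → Word → ℚ
f ⟦ u ∗ v ⟧ = ∑ (qsh u v) f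

⟦∗⟧-[]ˡ : ∀ f v → f ⟦ [] ∗ v ⟧ ≡ f v
⟦∗⟧-[]ˡ f v = ℚP.+-identityʳ (f v)

⟦∗⟧-[]ʳ : ∀ f u → f ⟦ u ∗ [] ⟧ ≡ f u
⟦∗⟧-[]ʳ f []      = ℚP.+-identityʳ (f [])
⟦∗⟧-[]ʳ f (m ∷ u) = ℚP.+-identityʳ (f (m ∷ u))

⟦∗⟧-∷ : ∀ f m u n v → f ⟦ m ∷ u ∗ n ∷ v ⟧ ≡
  (f ∘ (m ∷_)) ⟦ u ∗ n ∷ v ⟧ + ((f ∘ (n ∷_)) ⟦ m ∷ u ∗ v ⟧ + (f ∘ (m ℤ.+ n ∷_)) ⟦ u ∗ v ⟧)
⟦∗⟧-∷ f m u n v =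
  trans (∑-++ (map (m ∷_) U) _ f)
        (cong₂ _+_ (∑-map (m ∷_) U f)
                   (trans (∑-++ (map (n ∷_) V) _ f) (cong₂ _+_ (∑-map (n ∷_) V f) (∑-map _ W f))))
  where
  U = qsh u (n ∷ v)
  V = qsh (m ∷ u) v
  W = qsh u v

deconcat : Word → List (Word × Word)
deconcat []      = ([] , []) ∷ []
deconcat (k ∷ w) = ([] , k ∷ w) ∷ map (map₁ (k ∷_)) (deconcat w)

∑-deconcat-∷ : ∀ k w (F : Word × Word → ℚ) →
  ∑ (deconcat (k ∷ w)) F ≡ F ([] , k ∷ w) + ∑ (deconcat w) (F ∘ map₁ (k ∷_))
∑-deconcat-∷ k w F = cong (_+_ (F ([] , k ∷ w))) (∑-map (map₁ (k ∷_)) (deconcat w) F)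

_⊗_ : (Word → ℚ) → (Word → ℚ) → Word × Word → ℚ
(f ⊗ g) (u , v) = f u * g v

infixl 7 _⋆_

_⋆_ : (Word → ℚ) → (Word → ℚ) → Word → ℚ
(f ⋆ g) w = ∑ (deconcat w) (f ⊗ g)

⋆-∷ : ∀ f g k w → (f ⋆ g) (k ∷ w) ≡ f [] * g (k ∷ w) + ((f ∘ (k ∷_)) ⋆ g) w
⋆-∷ f g k w = ∑-deconcat-∷ k w (f ⊗ g)

-- (f ⊗ g)((x ⊗ y) ∗ Δv) and (f ⊗ g)(Δu ∗ Δv), where Δ is deconcatenation.
qshΔ : (Word → ℚ) → (Word → ℚ) → Word × Word → Word → ℚ
qshΔ f g (x , y) v = ∑ (deconcat v) (λ q → f ⟦ x ∗ proj₁ q ⟧ * g ⟦ y ∗ proj₂ q ⟧)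

qshΔΔ : (Word → ℚ) → (Word → ℚ) → Word → Word → ℚ
qshΔΔ f g u v = ∑ (deconcat u) (λ p → qshΔ f g p v)

qshΔ-∷∷ : ∀ f g m x y n v → qshΔ f g (m ∷ x , y) (n ∷ v) ≡
  qshΔ (f ∘ (m ∷_)) g (x , y) (n ∷ v) +
  (qshΔ (f ∘ (n ∷_)) g (m ∷ x , y) v + qshΔ (f ∘ (m ℤ.+ n ∷_)) g (x , y) v)
qshΔ-∷∷ f g m x y n v = begin
  qshΔ f g (m ∷ x , y) (n ∷ v)
    ≡⟨ ∑-deconcat-∷ n v (T f (m ∷ x)) ⟩
  f ⟦ m ∷ x ∗ [] ⟧ * G + ∑ (deconcat v) (T f (m ∷ x) ∘ map₁ (n ∷_))
    ≡⟨ cong₂ _+_ (cong (_* G) (trans (⟦∗⟧-[]ʳ f (m ∷ x)) (sym (⟦∗⟧-[]ʳ fm x))))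
                 (trans (∑-cong (deconcat v) (λ q → trans (cong (_* g₂ q) (⟦∗⟧-∷ f m x n (proj₁ q)))
                                                          (distribʳ₃ (fm ⟦ x ∗ n ∷ proj₁ q ⟧) (fn ⟦ m ∷ x ∗ proj₁ q ⟧)
                                                                      (fmn ⟦ x ∗ proj₁ q ⟧) (g₂ q))))
                        (∑-+₃ (deconcat v) (T fm x ∘ map₁ (n ∷_)) (T fn (m ∷ x)) (T fmn x))) ⟩
  fm ⟦ x ∗ [] ⟧ * G + (∑ (deconcat v) (T fm x ∘ map₁ (n ∷_)) + (S fn (m ∷ x) + S fmn x))
    ≡⟨ ℚP.+-assoc (fm ⟦ x ∗ [] ⟧ * G) _ _ ⟨
  fm ⟦ x ∗ [] ⟧ * G + ∑ (deconcat v) (T fm x ∘ map₁ (n ∷_)) + (S fn (m ∷ x) + S fmn x)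
    ≡⟨ cong (_+ (S fn (m ∷ x) + S fmn x)) (∑-deconcat-∷ n v (T fm x)) ⟨
  qshΔ fm g (x , y) (n ∷ v) + (S fn (m ∷ x) + S fmn x) ∎
  where
  open ≡-Reasoning
  fm = f ∘ (m ∷_)
  fn = f ∘ (n ∷_)
  fmn = f ∘ (m ℤ.+ n ∷_)
  G = g ⟦ y ∗ n ∷ v ⟧
  g₂ : Word × Word → ℚ
  g₂ q = g ⟦ y ∗ proj₂ q ⟧
  T : (Word → ℚ) → Word → Word × Word → ℚ
  T h a q = h ⟦ a ∗ proj₁ q ⟧ * g₂ q
  S : (Word → ℚ) → Word → ℚ
  S h a = ∑ (deconcat v) (T h a)
  distribʳ₃ : ∀ a b c d → (a + (b + c)) * d ≡ a * d + (b * d + c * d)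
  distribʳ₃ = solve 4 (λ a b c d → (a :+ (b :+ c)) :* d := a :* d :+ (b :* d :+ c :* d)) refl

qshΔΔ-∷∷ : ∀ f g m u n v → qshΔΔ f g (m ∷ u) (n ∷ v) ≡
  f [] * g ⟦ m ∷ u ∗ n ∷ v ⟧ +
  (qshΔΔ (f ∘ (m ∷_)) g u (n ∷ v) +
   (qshΔΔ (f ∘ (n ∷_)) g (m ∷ u) v + qshΔΔ (f ∘ (m ℤ.+ n ∷_)) g u v))
qshΔΔ-∷∷ f g m u n v = begin
  qshΔΔ f g (m ∷ u) (n ∷ v)
    ≡⟨ ∑-deconcat-∷ m u (λ p → qshΔ f g p (n ∷ v)) ⟩
  qshΔ f g ([] , m ∷ u) (n ∷ v) + ∑ (deconcat u) (λ p → qshΔ f g (m ∷ proj₁ p , proj₂ p) (n ∷ v))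
    ≡⟨ cong₂ _+_ (∑-deconcat-∷ n v (λ q → f ⟦ [] ∗ proj₁ q ⟧ * g ⟦ m ∷ u ∗ proj₂ q ⟧))
                 (trans (∑-cong (deconcat u) (λ p → qshΔ-∷∷ f g m (proj₁ p) (proj₂ p) n v))
                        (∑-+₃ (deconcat u) (λ p → qshΔ fm g p (n ∷ v)) S′ (λ p → qshΔ fmn g p v))) ⟩
  f ⟦ [] ∗ [] ⟧ * Gu + qshΔ fn g ([] , m ∷ u) v +
    (qshΔΔ fm g u (n ∷ v) + (∑ (deconcat u) S′ + qshΔΔ fmn g u v))
    ≡⟨ cong (λ z → z * Gu + qshΔ fn g ([] , m ∷ u) v + rest) (⟦∗⟧-[]ˡ f []) ⟩
  f [] * Gu + qshΔ fn g ([] , m ∷ u) v +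
    (qshΔΔ fm g u (n ∷ v) + (∑ (deconcat u) S′ + qshΔΔ fmn g u v))
    ≡⟨ rearrange (f [] * Gu) (qshΔ fn g ([] , m ∷ u) v) (qshΔΔ fm g u (n ∷ v))
                 (∑ (deconcat u) S′) (qshΔΔ fmn g u v) ⟩
  f [] * Gu + (qshΔΔ fm g u (n ∷ v) +
    ((qshΔ fn g ([] , m ∷ u) v + ∑ (deconcat u) S′) + qshΔΔ fmn g u v))
    ≡⟨ cong (λ z → f [] * Gu + (qshΔΔ fm g u (n ∷ v) + (z + qshΔΔ fmn g u v)))
            (∑-deconcat-∷ m u (λ p → qshΔ fn g p v)) ⟨
  f [] * Gu + (qshΔΔ fm g u (n ∷ v) + (qshΔΔ fn g (m ∷ u) v + qshΔΔ fmn g u v)) ∎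
  where
  open ≡-Reasoning
  fm = f ∘ (m ∷_)
  fn = f ∘ (n ∷_)
  fmn = f ∘ (m ℤ.+ n ∷_)
  Gu = g ⟦ m ∷ u ∗ n ∷ v ⟧
  S′ : Word × Word → ℚ
  S′ p = qshΔ fn g (m ∷ proj₁ p , proj₂ p) v
  rest = qshΔΔ fm g u (n ∷ v) + (∑ (deconcat u) S′ + qshΔΔ fmn g u v)
  rearrange : ∀ a b c d e → a + b + (c + (d + e)) ≡ a + (c + ((b + d) + e))
  rearrange = solve 5 (λ a b c d e → a :+ b :+ (c :+ (d :+ e)) := a :+ (c :+ ((b :+ d) :+ e))) refl

⋆-multiplicative : ∀ f g u v → (f ⋆ g) ⟦ u ∗ v ⟧ ≡ qshΔΔ f g u v
⋆-multiplicative f g [] v =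
  cong (_+ 0ℚ) (∑-cong (deconcat v) λ q → sym (cong₂ _*_ (⟦∗⟧-[]ˡ f (proj₁ q)) (⟦∗⟧-[]ˡ g (proj₂ q))))
⋆-multiplicative f g (m ∷ u) [] =
  trans (ℚP.+-identityʳ _)
        (∑-cong (deconcat (m ∷ u)) λ p →
          sym (trans (ℚP.+-identityʳ _) (cong₂ _*_ (⟦∗⟧-[]ʳ f (proj₁ p)) (⟦∗⟧-[]ʳ g (proj₂ p)))))
⋆-multiplicative f g (m ∷ u) (n ∷ v) = begin
  (f ⋆ g) ⟦ m ∷ u ∗ n ∷ v ⟧
    ≡⟨ ⟦∗⟧-∷ (f ⋆ g) m u n v ⟩
  ((f ⋆ g) ∘ (m ∷_)) ⟦ u ∗ n ∷ v ⟧ + (((f ⋆ g) ∘ (n ∷_)) ⟦ m ∷ u ∗ v ⟧ + ((f ⋆ g) ∘ (m ℤ.+ n ∷_)) ⟦ u ∗ v ⟧)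
    ≡⟨ cong₂ _+_ (shifted m u (n ∷ v)) (cong₂ _+_ (shifted n (m ∷ u) v) (shifted (m ℤ.+ n) u v)) ⟩
  (f [] * (g ∘ (m ∷_)) ⟦ u ∗ n ∷ v ⟧ + qshΔΔ (f ∘ (m ∷_)) g u (n ∷ v)) +
  ((f [] * (g ∘ (n ∷_)) ⟦ m ∷ u ∗ v ⟧ + qshΔΔ (f ∘ (n ∷_)) g (m ∷ u) v) +
   (f [] * (g ∘ (m ℤ.+ n ∷_)) ⟦ u ∗ v ⟧ + qshΔΔ (f ∘ (m ℤ.+ n ∷_)) g u v))
    ≡⟨ collect (f []) _ _ _ _ _ _ ⟩
  f [] * ((g ∘ (m ∷_)) ⟦ u ∗ n ∷ v ⟧ + ((g ∘ (n ∷_)) ⟦ m ∷ u ∗ v ⟧ + (g ∘ (m ℤ.+ n ∷_)) ⟦ u ∗ v ⟧)) +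
  (qshΔΔ (f ∘ (m ∷_)) g u (n ∷ v) + (qshΔΔ (f ∘ (n ∷_)) g (m ∷ u) v + qshΔΔ (f ∘ (m ℤ.+ n ∷_)) g u v))
    ≡⟨ cong (λ z → f [] * z + rest) (⟦∗⟧-∷ g m u n v) ⟨
  _ ≡⟨ qshΔΔ-∷∷ f g m u n v ⟨
  qshΔΔ f g (m ∷ u) (n ∷ v) ∎
  where
  open ≡-Reasoning
  rest = qshΔΔ (f ∘ (m ∷_)) g u (n ∷ v) + (qshΔΔ (f ∘ (n ∷_)) g (m ∷ u) v + qshΔΔ (f ∘ (m ℤ.+ n ∷_)) g u v)
  shifted : ∀ k x y → ((f ⋆ g) ∘ (k ∷_)) ⟦ x ∗ y ⟧ ≡
            f [] * (g ∘ (k ∷_)) ⟦ x ∗ y ⟧ + qshΔΔ (f ∘ (k ∷_)) g x y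
  shifted k x y = begin
    ∑ (qsh x y) ((f ⋆ g) ∘ (k ∷_))
      ≡⟨ ∑-cong (qsh x y) (⋆-∷ f g k) ⟩
    ∑ (qsh x y) (λ w → f [] * g (k ∷ w) + ((f ∘ (k ∷_)) ⋆ g) w)
      ≡⟨ ∑-+ (qsh x y) _ _ ⟩
    ∑ (qsh x y) (λ w → f [] * g (k ∷ w)) + ((f ∘ (k ∷_)) ⋆ g) ⟦ x ∗ y ⟧
      ≡⟨ cong₂ _+_ (∑-*ˡ (qsh x y) (f []) (g ∘ (k ∷_))) (⋆-multiplicative (f ∘ (k ∷_)) g x y) ⟩
    f [] * (g ∘ (k ∷_)) ⟦ x ∗ y ⟧ + qshΔΔ (f ∘ (k ∷_)) g x y ∎
  collect : ∀ a b c d e h i → (a * b + e) + ((a * c + h) + (a * d + i)) ≡ a * (b + (c + d)) + (e + (h + i))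
  collect = solve 7 (λ a b c d e h i →
    (a :* b :+ e) :+ ((a :* c :+ h) :+ (a :* d :+ i)) := a :* (b :+ (c :+ d)) :+ (e :+ (h :+ i))) refl

⋆-identityˡ : ∀ h w → (εw ⋆ h) w ≡ h w
⋆-identityˡ h []      = trans (ℚP.+-identityʳ _) (ℚP.*-identityˡ (h []))
⋆-identityˡ h (k ∷ w) = begin
  (εw ⋆ h) (k ∷ w)                    ≡⟨ ⋆-∷ εw h k w ⟩
  1ℚ * h (k ∷ w) + (εw ∘ (k ∷_) ⋆ h) w ≡⟨ cong₂ _+_ (ℚP.*-identityˡ (h (k ∷ w))) vanishing ⟩
  h (k ∷ w) + 0ℚ                       ≡⟨ ℚP.+-identityʳ _ ⟩
  h (k ∷ w)                            ∎
  where
  open ≡-Reasoning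
  vanishing : (εw ∘ (k ∷_) ⋆ h) w ≡ 0ℚ
  vanishing = trans (∑-cong (deconcat w) (λ q → ℚP.*-zeroˡ (h (proj₂ q)))) (∑-zero (deconcat w))

⋆-identityʳ : ∀ h w → (h ⋆ εw) w ≡ h w
⋆-identityʳ h []      = trans (ℚP.+-identityʳ _) (ℚP.*-identityʳ (h []))
⋆-identityʳ h (k ∷ w) =
  trans (⋆-∷ h εw k w)
        (trans (cong₂ _+_ (ℚP.*-zeroʳ (h [])) (⋆-identityʳ (h ∘ (k ∷_)) w)) (ℚP.+-identityˡ _))

IsInfCharℚ : (Word → ℚ) → Set
IsInfCharℚ h = ∀ u v → h ⟦ u ∗ v ⟧ ≡ h u * εw v + εw u * h v

qshΔΔ-IsInfCharℚ : ∀ {h k} → IsInfCharℚ h → IsInfCharℚ k → ∀ u v → qshΔΔ h k u v ≡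
  (h ⋆ k) u * εw v + (h u * k v + (k u * h v + εw u * (h ⋆ k) v))
qshΔΔ-IsInfCharℚ {h} {k} h-inf k-inf u v = begin
  qshΔΔ h k u v
    ≡⟨ ∑-cong Δu (λ p → ∑-cong Δv (λ q → expand p q)) ⟩
  ∑∑ (λ p q → T₁ p q + (T₂ p q + (T₃ p q + T₄ p q)))
    ≡⟨ trans (∑∑-+ Δu Δv T₁ (λ p q → T₂ p q + (T₃ p q + T₄ p q))) (cong (_+_ (∑∑ T₁))
        (trans (∑∑-+ Δu Δv T₂ (λ p q → T₃ p q + T₄ p q)) (cong (_+_ (∑∑ T₂)) (∑∑-+ Δu Δv T₃ T₄)))) ⟩
  ∑∑ T₁ + (∑∑ T₂ + (∑∑ T₃ + ∑∑ T₄))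
    ≡⟨ cong₂ _+_ (∑∑-* Δu Δv (h ⊗ k) (εw ⊗ εw)) (cong₂ _+_ (∑∑-* Δu Δv (h ⊗ εw) (εw ⊗ k))
                 (cong₂ _+_ (∑∑-* Δu Δv (εw ⊗ k) (h ⊗ εw)) (∑∑-* Δu Δv (εw ⊗ εw) (h ⊗ k)))) ⟩
  (h ⋆ k) u * (εw ⋆ εw) v +
  ((h ⋆ εw) u * (εw ⋆ k) v + ((εw ⋆ k) u * (h ⋆ εw) v + (εw ⋆ εw) u * (h ⋆ k) v))
    ≡⟨ cong₂ _+_ (cong (_*_ ((h ⋆ k) u)) (⋆-identityˡ εw v))
                 (cong₂ _+_ (cong₂ _*_ (⋆-identityʳ h u) (⋆-identityˡ k v))
                            (cong₂ _+_ (cong₂ _*_ (⋆-identityˡ k u) (⋆-identityʳ h v))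
                                       (cong (_* (h ⋆ k) v) (⋆-identityˡ εw u)))) ⟩
  (h ⋆ k) u * εw v + (h u * k v + (k u * h v + εw u * (h ⋆ k) v)) ∎
  where
  open ≡-Reasoning
  Δu = deconcat u
  Δv = deconcat v
  ∑∑ : (Word × Word → Word × Word → ℚ) → ℚ
  ∑∑ F = ∑ Δu (λ p → ∑ Δv (F p))
  T₁ T₂ T₃ T₄ : Word × Word → Word × Word → ℚ
  T₁ p q = (h ⊗ k) p * (εw ⊗ εw) q
  T₂ p q = (h ⊗ εw) p * (εw ⊗ k) q
  T₃ p q = (εw ⊗ k) p * (h ⊗ εw) q
  T₄ p q = (εw ⊗ εw) p * (h ⊗ k) q
  expand : ∀ p q → h ⟦ proj₁ p ∗ proj₁ q ⟧ * k ⟦ proj₂ p ∗ proj₂ q ⟧ ≡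
                   T₁ p q + (T₂ p q + (T₃ p q + T₄ p q))
  expand (x , y) (x′ , y′) =
    trans (cong₂ _*_ (h-inf x x′) (k-inf y y′))
          (solve 8 (λ hx ex ky ey hx′ ex′ ky′ ey′ →
             (hx :* ex′ :+ ex :* hx′) :* (ky :* ey′ :+ ey :* ky′) :=
             hx :* ky :* (ex′ :* ey′) :+ (hx :* ey :* (ex′ :* ky′) :+
             (ex :* ky :* (hx′ :* ey′) :+ ex :* ey :* (hx′ :* ky′)))) refl
             (h x) (εw x) (k y) (εw y) (h x′) (εw x′) (k y′) (εw y′))

⟦∗⟧-minus : ∀ f g u v → (λ w → f w - g w) ⟦ u ∗ v ⟧ ≡ f ⟦ u ∗ v ⟧ - g ⟦ u ∗ v ⟧
⟦∗⟧-minus f g u v = trans (∑-+ (qsh u v) f (λ w → - g w)) (cong (_+_ (f ⟦ u ∗ v ⟧)) (∑-neg (qsh u v) g))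

⁅_,_⁆ : (Word → ℚ) → (Word → ℚ) → Word → ℚ
⁅ h , k ⁆ w = (h ⋆ k) w - (k ⋆ h) w

⁅⁆-IsInfCharℚ : ∀ {h k} → IsInfCharℚ h → IsInfCharℚ k → IsInfCharℚ ⁅ h , k ⁆
⁅⁆-IsInfCharℚ {h} {k} h-inf k-inf u v = begin
  ⁅ h , k ⁆ ⟦ u ∗ v ⟧
    ≡⟨ ⟦∗⟧-minus (h ⋆ k) (k ⋆ h) u v ⟩
  (h ⋆ k) ⟦ u ∗ v ⟧ - (k ⋆ h) ⟦ u ∗ v ⟧
    ≡⟨ cong₂ _-_ (trans (⋆-multiplicative h k u v) (qshΔΔ-IsInfCharℚ h-inf k-inf u v))
                 (trans (⋆-multiplicative k h u v) (qshΔΔ-IsInfCharℚ k-inf h-inf u v)) ⟩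
  ((h ⋆ k) u * εw v + (h u * k v + (k u * h v + εw u * (h ⋆ k) v))) -
  ((k ⋆ h) u * εw v + (k u * h v + (h u * k v + εw u * (k ⋆ h) v)))
    ≡⟨ cancel ((h ⋆ k) u) ((k ⋆ h) u) ((h ⋆ k) v) ((k ⋆ h) v) (h u * k v) (k u * h v) (εw u) (εw v) ⟩
  ⁅ h , k ⁆ u * εw v + εw u * ⁅ h , k ⁆ v ∎
  where
  open ≡-Reasoning
  cancel : ∀ a b c d x y eu ev → (a * ev + (x + (y + eu * c))) - (b * ev + (y + (x + eu * d))) ≡
                                 (a - b) * ev + eu * (c - d)
  cancel = solve 8 (λ a b c d x y eu ev →
    (a :* ev :+ (x :+ (y :+ eu :* c))) :- (b :* ev :+ (y :+ (x :+ eu :* d))) :=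
    (a :- b) :* ev :+ eu :* (c :- d)) refl

sign : Word → ℚ
sign []      = 1ℚ
sign (_ ∷ w) = - sign w

sign-⟦∗⟧ : ∀ u v → sign ⟦ u ∗ v ⟧ ≡ sign u * sign v
sign-⟦∗⟧ []      v       = trans (ℚP.+-identityʳ (sign v)) (sym (ℚP.*-identityˡ (sign v)))
sign-⟦∗⟧ (m ∷ u) []      = trans (ℚP.+-identityʳ (sign (m ∷ u))) (sym (ℚP.*-identityʳ (sign (m ∷ u))))
sign-⟦∗⟧ (m ∷ u) (n ∷ v) = begin
  sign ⟦ m ∷ u ∗ n ∷ v ⟧
    ≡⟨ ⟦∗⟧-∷ sign m u n v ⟩
  (sign ∘ (m ∷_)) ⟦ u ∗ n ∷ v ⟧ + ((sign ∘ (n ∷_)) ⟦ m ∷ u ∗ v ⟧ + (sign ∘ (m ℤ.+ n ∷_)) ⟦ u ∗ v ⟧)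
    ≡⟨ cong₂ _+_ (negated u (n ∷ v)) (cong₂ _+_ (negated (m ∷ u) v) (negated u v)) ⟩
  - (sign u * - sign v) + (- (- sign u * sign v) + - (sign u * sign v))
    ≡⟨ solve 2 (λ a b → :- (a :* (:- b)) :+ (:- ((:- a) :* b) :+ :- (a :* b)) := (:- a) :* (:- b))
             refl (sign u) (sign v) ⟩
  - sign u * - sign v ∎
  where
  open ≡-Reasoning
  negated : ∀ x y → (λ w → - sign w) ⟦ x ∗ y ⟧ ≡ - (sign x * sign y)
  negated x y = trans (∑-neg (qsh x y) sign) (cong -_ (sign-⟦∗⟧ x y))

ζ : Word → ℚ
ζ []      = 0ℚ
ζ (k ∷ w) = fromℤ k * sign w

ζ-IsInfCharℚ : IsInfCharℚ ζ
ζ-IsInfCharℚ []      v       =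
  solve 2 (λ z e → z :+ con 0ℚ := con 0ℚ :* e :+ con 1ℚ :* z) refl (ζ v) (εw v)
ζ-IsInfCharℚ (m ∷ u) []      =
  solve 1 (λ z → z :+ con 0ℚ := z :* con 1ℚ :+ con 0ℚ :* con 0ℚ) refl (ζ (m ∷ u))
ζ-IsInfCharℚ (m ∷ u) (n ∷ v) = begin
  ζ ⟦ m ∷ u ∗ n ∷ v ⟧
    ≡⟨ ⟦∗⟧-∷ ζ m u n v ⟩
  (ζ ∘ (m ∷_)) ⟦ u ∗ n ∷ v ⟧ + ((ζ ∘ (n ∷_)) ⟦ m ∷ u ∗ v ⟧ + (ζ ∘ (m ℤ.+ n ∷_)) ⟦ u ∗ v ⟧)
    ≡⟨ cong₂ _+_ (scaled m u (n ∷ v)) (cong₂ _+_ (scaled n (m ∷ u) v) (scaled (m ℤ.+ n) u v)) ⟩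
  fromℤ m * (sign u * - sign v) + (fromℤ n * (- sign u * sign v) + fromℤ (m ℤ.+ n) * (sign u * sign v))
    ≡⟨ cong (λ z → fromℤ m * (sign u * - sign v) + (fromℤ n * (- sign u * sign v) + z * (sign u * sign v)))
            (fromℤ-+ m n) ⟩
  fromℤ m * (sign u * - sign v) + (fromℤ n * (- sign u * sign v) + (fromℤ m + fromℤ n) * (sign u * sign v))
    ≡⟨ solve 6 (λ x y a b zu zv → x :* (a :* (:- b)) :+ (y :* ((:- a) :* b) :+ (x :+ y) :* (a :* b)) :=
                                 zu :* con 0ℚ :+ con 0ℚ :* zv)
             refl (fromℤ m) (fromℤ n) (sign u) (sign v) (ζ (m ∷ u)) (ζ (n ∷ v)) ⟩
  ζ (m ∷ u) * 0ℚ + 0ℚ * ζ (n ∷ v) ∎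
  where
  open ≡-Reasoning
  scaled : ∀ k x y → (ζ ∘ (k ∷_)) ⟦ x ∗ y ⟧ ≡ fromℤ k * (sign x * sign y)
  scaled k x y = trans (∑-*ˡ (qsh x y) (fromℤ k) sign) (cong (_*_ (fromℤ k)) (sign-⟦∗⟧ x y))

weight : Word → ℤ
weight []      = + 0
weight (k ∷ w) = k ℤ.+ weight w

weight-++ : ∀ x y → weight (x ++ y) ≡ weight x ℤ.+ weight y
weight-++ []      y = sym (ℤP.+-identityˡ (weight y))
weight-++ (k ∷ x) y = trans (cong (ℤ._+_ k) (weight-++ x y)) (sym (ℤP.+-assoc k (weight x) (weight y)))

⟦∗⟧-weight : ∀ (F : ℤ → Word → ℚ) u v →
  (λ w → F (weight w) w) ⟦ u ∗ v ⟧ ≡ F (weight u ℤ.+ weight v) ⟦ u ∗ v ⟧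
⟦∗⟧-weight F []      v       = cong (λ t → F t v + 0ℚ) (sym (ℤP.+-identityˡ (weight v)))
⟦∗⟧-weight F (m ∷ u) []      = cong (λ t → F t (m ∷ u) + 0ℚ) (sym (ℤP.+-identityʳ (weight (m ∷ u))))
⟦∗⟧-weight F (m ∷ u) (n ∷ v) = begin
  (λ w → F (weight w) w) ⟦ m ∷ u ∗ n ∷ v ⟧
    ≡⟨ ⟦∗⟧-∷ (λ w → F (weight w) w) m u n v ⟩
  _ ≡⟨ cong₂ _+_ (shifted m u (n ∷ v) (regroup₁ m (weight u) n (weight v)))
                 (cong₂ _+_ (shifted n (m ∷ u) v (regroup₂ m (weight u) n (weight v)))
                            (shifted (m ℤ.+ n) u v (regroup₃ m (weight u) n (weight v)))) ⟩
  _ ≡⟨ ⟦∗⟧-∷ (F (weight (m ∷ u) ℤ.+ weight (n ∷ v))) m u n v ⟨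
  F (weight (m ∷ u) ℤ.+ weight (n ∷ v)) ⟦ m ∷ u ∗ n ∷ v ⟧ ∎
  where
  open ≡-Reasoning
  shifted : ∀ k x y {t} → k ℤ.+ (weight x ℤ.+ weight y) ≡ t →
            (λ w → F (weight (k ∷ w)) (k ∷ w)) ⟦ x ∗ y ⟧ ≡ (F t ∘ (k ∷_)) ⟦ x ∗ y ⟧
  shifted k x y eq = trans (⟦∗⟧-weight (λ t w → F (k ℤ.+ t) (k ∷ w)) x y)
                           (cong (λ t → (F t ∘ (k ∷_)) ⟦ x ∗ y ⟧) eq)
  regroup₁ : ∀ m U n V → m ℤ.+ (U ℤ.+ (n ℤ.+ V)) ≡ (m ℤ.+ U) ℤ.+ (n ℤ.+ V)
  regroup₁ = ℤSolver.solve-∀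
  regroup₂ : ∀ m U n V → n ℤ.+ ((m ℤ.+ U) ℤ.+ V) ≡ (m ℤ.+ U) ℤ.+ (n ℤ.+ V)
  regroup₂ = ℤSolver.solve-∀
  regroup₃ : ∀ m U n V → (m ℤ.+ n) ℤ.+ (U ℤ.+ V) ≡ (m ℤ.+ U) ℤ.+ (n ℤ.+ V)
  regroup₃ = ℤSolver.solve-∀

δ : ℤ → ℤ → ℚ
δ c t with c ℤ.≟ t
... | yes _ = 1ℚ
... | no  _ = 0ℚ

δ-refl : ∀ c → δ c c ≡ 1ℚ
δ-refl c with c ℤ.≟ c
... | yes _   = refl
... | no  c≢c = contradiction refl c≢c

δ-≢ : ∀ {c t} → c ≢ t → δ c t ≡ 0ℚ
δ-≢ {c} {t} c≢t with c ℤ.≟ t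
... | yes c≡t = contradiction c≡t c≢t
... | no  _   = refl

weightPart : ℤ → (Word → ℚ) → Word → ℚ
weightPart c h w = δ c (weight w) * h w

weightPart-vanishes : ∀ c h {w} → weight w ≢ c → weightPart c h w ≡ 0ℚ
weightPart-vanishes c h {w} w≢c = trans (cong (_* h w) (δ-≢ (w≢c ∘ sym))) (ℚP.*-zeroˡ (h w))

δ-+weight-εw : ∀ c a v → δ c (a ℤ.+ weight v) * εw v ≡ δ c a * εw v
δ-+weight-εw c a []      = cong (λ t → δ c t * 1ℚ) (ℤP.+-identityʳ a)
δ-+weight-εw c a (k ∷ v) = trans (ℚP.*-zeroʳ (δ c (a ℤ.+ weight (k ∷ v)))) (sym (ℚP.*-zeroʳ (δ c a)))

weightPart-IsInfCharℚ : ∀ c {h} → IsInfCharℚ h → IsInfCharℚ (weightPart c h)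
weightPart-IsInfCharℚ c {h} h-inf u v = begin
  weightPart c h ⟦ u ∗ v ⟧
    ≡⟨ ⟦∗⟧-weight (λ t w → δ c t * h w) u v ⟩
  (λ w → δ c (wu ℤ.+ wv) * h w) ⟦ u ∗ v ⟧
    ≡⟨ ∑-*ˡ (qsh u v) (δ c (wu ℤ.+ wv)) h ⟩
  δ c (wu ℤ.+ wv) * h ⟦ u ∗ v ⟧
    ≡⟨ cong (_*_ (δ c (wu ℤ.+ wv))) (h-inf u v) ⟩
  δ c (wu ℤ.+ wv) * (h u * εw v + εw u * h v)
    ≡⟨ distribute (δ c (wu ℤ.+ wv)) (h u) (εw v) (εw u) (h v) ⟩
  (δ c (wu ℤ.+ wv) * εw v) * h u + (δ c (wu ℤ.+ wv) * εw u) * h v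
    ≡⟨ cong₂ _+_ (cong (_* h u) (δ-+weight-εw c wu v))
                 (cong (_* h v) (trans (cong (λ t → δ c t * εw u) (ℤP.+-comm wu wv)) (δ-+weight-εw c wv u))) ⟩
  (δ c wu * εw v) * h u + (δ c wv * εw u) * h v
    ≡⟨ regroup (δ c wu) (εw v) (h u) (δ c wv) (εw u) (h v) ⟩
  weightPart c h u * εw v + εw u * weightPart c h v ∎
  where
  open ≡-Reasoning
  wu = weight u
  wv = weight v
  distribute : ∀ d a e e′ b → d * (a * e + e′ * b) ≡ (d * e) * a + (d * e′) * b
  distribute = solve 5 (λ d a e e′ b → d :* (a :* e :+ e′ :* b) := (d :* e) :* a :+ (d :* e′) :* b) refl
  regroup : ∀ d e a d′ e′ b → (d * e) * a + (d′ * e′) * b ≡ d * a * e + e′ * (d′ * b)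
  regroup = solve 6 (λ d e a d′ e′ b → (d :* e) :* a :+ (d′ :* e′) :* b := d :* a :* e :+ e′ :* (d′ :* b)) refl

⋆-vanishes : ∀ f g w → (∀ x y → x ++ y ≡ w → f x * g y ≡ 0ℚ) → (f ⋆ g) w ≡ 0ℚ
⋆-vanishes f g []      fg≡0 = trans (ℚP.+-identityʳ (f [] * g [])) (fg≡0 [] [] refl)
⋆-vanishes f g (k ∷ w) fg≡0 = begin
  (f ⋆ g) (k ∷ w)                     ≡⟨ ⋆-∷ f g k w ⟩
  f [] * g (k ∷ w) + (f ∘ (k ∷_) ⋆ g) w ≡⟨ cong₂ _+_ (fg≡0 [] (k ∷ w) refl)
                                                     (⋆-vanishes (f ∘ (k ∷_)) g w
                                                       (λ x y eq → fg≡0 (k ∷ x) y (cong (k ∷_) eq))) ⟩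
  0ℚ + 0ℚ                              ≡⟨ ℚP.+-identityʳ 0ℚ ⟩
  0ℚ                                   ∎
  where open ≡-Reasoning

weightPart-⋆-vanishes : ∀ a b f g {w} → weight w ≢ a ℤ.+ b →
  (weightPart a f ⋆ weightPart b g) w ≡ 0ℚ
weightPart-⋆-vanishes a b f g {w} w≢a+b = ⋆-vanishes (weightPart a f) (weightPart b g) w vanishing
  where
  vanishing : ∀ x y → x ++ y ≡ w → weightPart a f x * weightPart b g y ≡ 0ℚ
  vanishing x y x++y≡w with weight x ℤ.≟ a | weight y ℤ.≟ b
  ... | yes x≡a | yes y≡b =
    contradiction (trans (sym (cong weight x++y≡w)) (trans (weight-++ x y) (cong₂ ℤ._+_ x≡a y≡b))) w≢a+b
  ... | no x≢a | _ =
    trans (cong (_* weightPart b g y) (weightPart-vanishes a f x≢a)) (ℚP.*-zeroˡ (weightPart b g y))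
  ... | yes _ | no y≢b =
    trans (cong (_*_ (weightPart a f x)) (weightPart-vanishes b g y≢b)) (ℚP.*-zeroʳ (weightPart a f x))

η : ℤ → Word → ℚ
η a = ⁅ weightPart a ζ , weightPart (+ 1 ℤ.- a) ζ ⁆

η-IsInfCharℚ : ∀ a → IsInfCharℚ (η a)
η-IsInfCharℚ a =
  ⁅⁆-IsInfCharℚ (weightPart-IsInfCharℚ a ζ-IsInfCharℚ) (weightPart-IsInfCharℚ (+ 1 ℤ.- a) ζ-IsInfCharℚ)

η-vanishes : ∀ a {w} → weight w ≢ + 1 → η a w ≡ 0ℚ
η-vanishes a {w} w≢1 =
  cong₂ _-_ (weightPart-⋆-vanishes a b ζ ζ {w} (w≢1 ∘ flip trans (a+b≡1 a)))
            (weightPart-⋆-vanishes b a ζ ζ {w} (w≢1 ∘ flip trans (b+a≡1 a)))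
  where
  b = + 1 ℤ.- a
  a+b≡1 : ∀ a → a ℤ.+ (+ 1 ℤ.- a) ≡ + 1
  a+b≡1 = ℤSolver.solve-∀
  b+a≡1 : ∀ a → (+ 1 ℤ.- a) ℤ.+ a ≡ + 1
  b+a≡1 = ℤSolver.solve-∀

condTail⇒< : ∀ j s k ks → condTail j s (k ∷ ks) → + j ℤ.< s ℤ.+ weight (k ∷ ks)
condTail⇒< j s k []         (j<s+k , _) = subst (λ t → + j ℤ.< s ℤ.+ t) (sym (ℤP.+-identityʳ k)) j<s+k
condTail⇒< j s k (k′ ∷ ks) (_ , rest) =
  ℤP.<-trans (+<+ (ℕP.n<1+n j))
             (subst (+ suc j ℤ.<_) (ℤP.+-assoc s k (weight (k′ ∷ ks))) (condTail⇒< (suc j) (s ℤ.+ k) k′ ks rest))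

NonSingular⇒weight≢1 : ∀ w → NonSingular w → weight w ≢ + 1
NonSingular⇒weight≢1 (k ∷ [])          (k≢1 , _)    k+0≡1 = k≢1 (trans (sym (ℤP.+-identityʳ k)) k+0≡1)
NonSingular⇒weight≢1 (k ∷ k′ ∷ [])     (_ , ¬bad , _) w≡1 =
  ¬bad (inj₂ (inj₁ (trans (cong (ℤ._+_ k) (sym (ℤP.+-identityʳ k′))) w≡1)))
NonSingular⇒weight≢1 (k ∷ k′ ∷ k″ ∷ ks) (_ , _ , tail) w≡1 =
  ℤP.<-asym (subst (+ 3 ℤ.<_) (trans (ℤP.+-assoc k k′ (weight (k″ ∷ ks))) w≡1)
                  (condTail⇒< 3 (k ℤ.+ k′) k″ ks tail))
            (+<+ (ℕ.s≤s (ℕ.s≤s ℕ.z≤n)))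

weightPart-ζ-letter : ∀ c k → weightPart c ζ (k ∷ []) ≡ δ c k * fromℤ k
weightPart-ζ-letter c k =
  cong₂ (λ t q → δ c t * q) (ℤP.+-identityʳ k) (ℚP.*-identityʳ (fromℤ k))

η-two-letters : ∀ a x y →
  η a (x ∷ y ∷ []) ≡ weightPart a ζ (x ∷ []) * weightPart (+ 1 ℤ.- a) ζ (y ∷ []) -
                     weightPart (+ 1 ℤ.- a) ζ (x ∷ []) * weightPart a ζ (y ∷ [])
η-two-letters a x y = cong₂ _-_ (ends-vanish a b) (ends-vanish b a)
  where
  b = + 1 ℤ.- a
  ends-vanish : ∀ c d → (weightPart c ζ ⋆ weightPart d ζ) (x ∷ y ∷ []) ≡
                        weightPart c ζ (x ∷ []) * weightPart d ζ (y ∷ [])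
  ends-vanish c d =
    trans (cong₂ (λ z z′ → z * r + (p * q + (s * z′ + 0ℚ))) (ℚP.*-zeroʳ (δ c (+ 0))) (ℚP.*-zeroʳ (δ d (+ 0))))
          (solve 4 (λ p q r s → con 0ℚ :* r :+ (p :* q :+ (s :* con 0ℚ :+ con 0ℚ)) := p :* q) refl p q r s)
    where
    p = weightPart c ζ (x ∷ [])
    q = weightPart d ζ (y ∷ [])
    r = weightPart d ζ (x ∷ y ∷ [])
    s = weightPart c ζ (x ∷ y ∷ [])

η-NonSingular : ∀ a w → NonSingular w → η a w ≡ 0ℚ
η-NonSingular a w = η-vanishes a {w} ∘ NonSingular⇒weight≢1 w

ξ : ℕ → Word → ℚ
ξ t = η (+ suc (suc t))

τ : ℕ → Word
τ s = + suc (suc s) ∷ -[1+ s ] ∷ []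

ξ-τ : ∀ t s → ξ t (τ s) ≡
  (δ (+ suc (suc t)) (+ suc (suc s)) * fromℤ (+ suc (suc s))) * (δ -[1+ t ] -[1+ s ] * fromℤ -[1+ s ])
ξ-τ t s = begin
  ξ t (τ s)
    ≡⟨ η-two-letters a x y ⟩
  weightPart a ζ (x ∷ []) * weightPart b ζ (y ∷ []) - weightPart b ζ (x ∷ []) * weightPart a ζ (y ∷ [])
    ≡⟨ cong₂ (λ p q → p - q * weightPart a ζ (y ∷ []))
             (cong₂ _*_ (weightPart-ζ-letter a x) (weightPart-ζ-letter b y))
             (trans (weightPart-ζ-letter b x) (trans (cong (_* fromℤ x) (δ-≢ {b} {x} λ ())) (ℚP.*-zeroˡ (fromℤ x)))) ⟩
  (δ a x * fromℤ x) * (δ b y * fromℤ y) - 0ℚ * weightPart a ζ (y ∷ [])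
    ≡⟨ solve 2 (λ p q → p :- con 0ℚ :* q := p) refl
             ((δ a x * fromℤ x) * (δ b y * fromℤ y)) (weightPart a ζ (y ∷ [])) ⟩
  (δ a x * fromℤ x) * (δ b y * fromℤ y) ∎
  where
  open ≡-Reasoning
  a = + suc (suc t)
  b = -[1+ t ]
  x = + suc (suc s)
  y = -[1+ s ]

ξ-τ-off-diagonal : ∀ t s → t ≢ s → ξ t (τ s) ≡ 0ℚ
ξ-τ-off-diagonal t s t≢s = begin
  ξ t (τ s)
    ≡⟨ ξ-τ t s ⟩
  (δ a x * fromℤ x) * (δ -[1+ t ] -[1+ s ] * fromℤ -[1+ s ])
    ≡⟨ cong (λ d → (d * fromℤ x) * (δ -[1+ t ] -[1+ s ] * fromℤ -[1+ s ])) (δ-≢ (t≢s ∘ suc-suc-injective)) ⟩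
  (0ℚ * fromℤ x) * (δ -[1+ t ] -[1+ s ] * fromℤ -[1+ s ])
    ≡⟨ solve 2 (λ p q → (con 0ℚ :* p) :* q := con 0ℚ) refl (fromℤ x) (δ -[1+ t ] -[1+ s ] * fromℤ -[1+ s ]) ⟩
  0ℚ ∎
  where
  open ≡-Reasoning
  a = + suc (suc t)
  x = + suc (suc s)
  suc-suc-injective : a ≡ x → t ≡ s
  suc-suc-injective refl = refl

ξ-τ-diagonal : ∀ t → ξ t (τ t) ≢ 0ℚ
ξ-τ-diagonal t ξtτt≡0 = x#0y#0→xy#0 (a≢0 ∘ fromℤ≡0⇒≡0 a) (b≢0 ∘ fromℤ≡0⇒≡0 b) (begin
  fromℤ a * fromℤ b                            ≡⟨ cong₂ _*_ (ℚP.*-identityˡ (fromℤ a)) (ℚP.*-identityˡ (fromℤ b)) ⟨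
  (1ℚ * fromℤ a) * (1ℚ * fromℤ b)              ≡⟨ cong₂ (λ d e → (d * fromℤ a) * (e * fromℤ b)) (δ-refl a) (δ-refl b) ⟨
  (δ a a * fromℤ a) * (δ b b * fromℤ b)        ≡⟨ ξ-τ t t ⟨
  ξ t (τ t)                                    ≡⟨ ξtτt≡0 ⟩
  0ℚ                                           ∎)
  where
  open ≡-Reasoning
  a = + suc (suc t)
  b = -[1+ t ]
  a≢0 : a ≢ + 0
  a≢0 ()
  b≢0 : b ≢ + 0
  b≢0 ()

linExtℚ : (Word → ℚ) → H → ℚ
linExtℚ h x = ∑ x (λ p → proj₁ p * h (proj₂ p))

ε≡linExtℚ-εw : ∀ x → ε x ≡ linExtℚ εw x
ε≡linExtℚ-εw []            = refl
ε≡linExtℚ-εw ((q , w) ∷ x) = cong (_+_ (q * εw w)) (ε≡linExtℚ-εw x)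

linExtℚ-cong : ∀ {f g} → (∀ w → f w ≡ g w) → ∀ x → linExtℚ f x ≡ linExtℚ g x
linExtℚ-cong f≗g x = ∑-cong x (λ p → cong (_*_ (proj₁ p)) (f≗g (proj₂ p)))

linExtℚ-+ : ∀ f g x → linExtℚ (λ w → f w + g w) x ≡ linExtℚ f x + linExtℚ g x
linExtℚ-+ f g x =
  trans (∑-cong x (λ p → ℚP.*-distribˡ-+ (proj₁ p) (f (proj₂ p)) (g (proj₂ p)))) (∑-+ x _ _)

linExtℚ-*ˡ : ∀ c f x → linExtℚ (λ w → c * f w) x ≡ c * linExtℚ f x
linExtℚ-*ˡ c f x = trans (∑-cong x (λ p → x∙yz≈y∙xz (proj₁ p) c (f (proj₂ p)))) (∑-*ˡ x c _)

linExtℚ-*ʳ : ∀ c f x → linExtℚ (λ w → f w * c) x ≡ linExtℚ f x * c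
linExtℚ-*ʳ c f x = trans (∑-cong x (λ p → sym (ℚP.*-assoc (proj₁ p) (f (proj₂ p)) c))) (∑-*ʳ x c _)

linExtℚ-∗ : ∀ h x y → linExtℚ h (x ∗ y) ≡ linExtℚ (λ u → linExtℚ (λ v → h ⟦ u ∗ v ⟧) y) x
linExtℚ-∗ h []            y = refl
linExtℚ-∗ h ((p , u) ∷ x) y =
  trans (∑-++ row (x ∗ y) _) (cong₂ _+_ row-value (linExtℚ-∗ h x y))
  where
  row = concatMap (λ q → map (λ w → (p * proj₁ q , w)) (qsh u (proj₂ q))) y
  row-value : linExtℚ h row ≡ p * linExtℚ (λ v → h ⟦ u ∗ v ⟧) y
  row-value = begin
    linExtℚ h row
      ≡⟨ ∑-concatMap _ y _ ⟩
    ∑ y (λ q → ∑ (map (λ w → (p * proj₁ q , w)) (qsh u (proj₂ q))) (λ r → proj₁ r * h (proj₂ r)))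
      ≡⟨ ∑-cong y (λ q → trans (∑-map _ (qsh u (proj₂ q)) _)
                        (trans (∑-*ˡ (qsh u (proj₂ q)) (p * proj₁ q) h)
                               (ℚP.*-assoc p (proj₁ q) _))) ⟩
    ∑ y (λ q → p * (proj₁ q * h ⟦ u ∗ proj₂ q ⟧))
      ≡⟨ ∑-*ˡ y p _ ⟩
    p * linExtℚ (λ v → h ⟦ u ∗ v ⟧) y ∎
    where open ≡-Reasoning

linExtℚ-IsInfCharℚ : ∀ {h} → IsInfCharℚ h → ∀ x y →
  linExtℚ h (x ∗ y) ≡ linExtℚ h x * ε y + ε x * linExtℚ h y
linExtℚ-IsInfCharℚ {h} h-inf x y = begin
  linExtℚ h (x ∗ y)
    ≡⟨ linExtℚ-∗ h x y ⟩
  linExtℚ (λ u → linExtℚ (λ v → h ⟦ u ∗ v ⟧) y) x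
    ≡⟨ linExtℚ-cong (λ u → trans (linExtℚ-cong (h-inf u) y) (inner u)) x ⟩
  linExtℚ (λ u → h u * ε y + εw u * linExtℚ h y) x
    ≡⟨ linExtℚ-+ (λ u → h u * ε y) (λ u → εw u * linExtℚ h y) x ⟩
  linExtℚ (λ u → h u * ε y) x + linExtℚ (λ u → εw u * linExtℚ h y) x
    ≡⟨ cong₂ _+_ (linExtℚ-*ʳ (ε y) h x)
                 (trans (linExtℚ-*ʳ (linExtℚ h y) εw x) (cong (_* linExtℚ h y) (sym (ε≡linExtℚ-εw x)))) ⟩
  linExtℚ h x * ε y + ε x * linExtℚ h y ∎
  where
  open ≡-Reasoning
  inner : ∀ u → linExtℚ (λ v → h u * εw v + εw u * h v) y ≡ h u * ε y + εw u * linExtℚ h y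
  inner u = trans (linExtℚ-+ (λ v → h u * εw v) (λ v → εw u * h v) y)
                  (cong₂ _+_ (trans (linExtℚ-*ˡ (h u) εw y) (cong (_*_ (h u)) (sym (ε≡linExtℚ-εw y))))
                             (linExtℚ-*ˡ (εw u) h y))

NonSingular⇒εw≡0 : ∀ w → NonSingular w → εw w ≡ 0ℚ
NonSingular⇒εw≡0 (_ ∷ _) _ = refl

linExtℚ-idealElem : ∀ {h} → IsInfCharℚ h → (∀ w → NonSingular w → h w ≡ 0ℚ) →
  ∀ g → linExtℚ h (idealElem g) ≡ 0ℚ
linExtℚ-idealElem         h-inf h-N []                    = refl
linExtℚ-idealElem {h} h-inf h-N (((n , ns) , y) ∷ g) = begin
  linExtℚ h (word n ∗ y ++ idealElem g)
    ≡⟨ ∑-++ (word n ∗ y) (idealElem g) _ ⟩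
  linExtℚ h (word n ∗ y) + linExtℚ h (idealElem g)
    ≡⟨ cong₂ _+_ (linExtℚ-IsInfCharℚ h-inf (word n) y) (linExtℚ-idealElem h-inf h-N g) ⟩
  (1ℚ * h n + 0ℚ) * ε y + (1ℚ * εw n + 0ℚ) * linExtℚ h y + 0ℚ
    ≡⟨ cong₂ (λ a b → (1ℚ * a + 0ℚ) * ε y + (1ℚ * b + 0ℚ) * linExtℚ h y + 0ℚ)
             (h-N n ns) (NonSingular⇒εw≡0 n ns) ⟩
  (1ℚ * 0ℚ + 0ℚ) * ε y + (1ℚ * 0ℚ + 0ℚ) * linExtℚ h y + 0ℚ
    ≡⟨ solve 2 (λ a b → (con 1ℚ :* con 0ℚ :+ con 0ℚ) :* a :+ (con 1ℚ :* con 0ℚ :+ con 0ℚ) :* b :+ con 0ℚ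
                        := con 0ℚ) refl (ε y) (linExtℚ h y) ⟩
  0ℚ ∎
  where open ≡-Reasoning

module _ {c ℓ : Level} (𝒜 : QAlgebra c ℓ) where
  open QAlgebra 𝒜
    using (_≈_; 0#; ι; ι-hom; reflexive; +-cong; *-congˡ; *-congʳ; zeroˡ; zeroʳ; +-identityˡ; +-identityʳ; setoid)
    renaming (_+_ to _+ᴬ_; _*_ to _*ᴬ_; refl to ≈-refl; sym to ≈-sym; trans to ≈-trans)
  open RingMorphisms.IsRingHomomorphism ι-hom using (0#-homo; 1#-homo; +-homo; *-homo)
  open import Relation.Binary.Reasoning.Setoid setoid

  linExt-ι : ∀ h x → linExt 𝒜 (ι ∘ h) x ≈ ι (linExtℚ h x)
  linExt-ι h []            = ≈-sym 0#-homo
  linExt-ι h ((q , w) ∷ x) =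
    ≈-trans (+-cong (≈-sym (*-homo q (h w))) (linExt-ι h x)) (≈-sym (+-homo (q * h w) (linExtℚ h x)))

  IsInfCharℚ⇒IsInfChar : ∀ {h} → IsInfCharℚ h → IsInfChar 𝒜 (ι ∘ h)
  IsInfCharℚ⇒IsInfChar {h} h-inf x y = begin
    linExt 𝒜 (ι ∘ h) (x ∗ y)                         ≈⟨ linExt-ι h (x ∗ y) ⟩
    ι (linExtℚ h (x ∗ y))                            ≈⟨ reflexive (cong ι (linExtℚ-IsInfCharℚ h-inf x y)) ⟩
    ι (linExtℚ h x * ε y + ε x * linExtℚ h y)        ≈⟨ +-homo _ _ ⟩
    ι (linExtℚ h x * ε y) +ᴬ ι (ε x * linExtℚ h y)   ≈⟨ +-cong (*-homo _ _) (*-homo _ _) ⟩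
    ι (linExtℚ h x) *ᴬ ι (ε y) +ᴬ ι (ε x) *ᴬ ι (linExtℚ h y)
      ≈⟨ +-cong (*-congʳ (linExt-ι h x)) (*-congˡ (linExt-ι h y)) ⟨
    linExt 𝒜 (ι ∘ h) x *ᴬ ι (ε y) +ᴬ ι (ε x) *ᴬ linExt 𝒜 (ι ∘ h) y ∎

  In𝔱-ι : ∀ {h} → IsInfCharℚ h → (∀ w → NonSingular w → h w ≡ 0ℚ) → In𝔱 𝒜 (ι ∘ h)
  In𝔱-ι {h} h-inf h-N =
    (λ g → ≈-trans (linExt-ι h (idealElem g)) (≈-trans (reflexive (cong ι (linExtℚ-idealElem h-inf h-N g))) 0#-homo)) ,
    IsInfCharℚ⇒IsInfChar h-inf

  ι≈0⇒≡0 : Nonzero 𝒜 → ∀ q → ι q ≈ 0# → q ≡ 0ℚ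
  ι≈0⇒≡0 1≉0 q ιq≈0 = decidable-stable (q ℚP.≟ 0ℚ) λ q≢0 → 1≉0 (begin
    QAlgebra.1# 𝒜                         ≈⟨ 1#-homo ⟨
    ι 1ℚ                                   ≈⟨ reflexive (cong ι (ℚP.*-inverseʳ q {{ℚ.≢-nonZero q≢0}})) ⟨
    ι (q * ℚ.1/_ q {{ℚ.≢-nonZero q≢0}})    ≈⟨ *-homo q _ ⟩
    ι q *ᴬ ι (ℚ.1/_ q {{ℚ.≢-nonZero q≢0}}) ≈⟨ *-congʳ ιq≈0 ⟩
    0# *ᴬ ι (ℚ.1/_ q {{ℚ.≢-nonZero q≢0}})  ≈⟨ zeroˡ _ ⟩
    0#                                     ∎)

  linComb-vanishes : ∀ n cs ξs w → (∀ j → ξs j w ≈ 0#) → linComb 𝒜 n cs ξs w ≈ 0#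
  linComb-vanishes zero    cs ξs w ξs≈0 = ≈-refl
  linComb-vanishes (suc n) cs ξs w ξs≈0 =
    ≈-trans (+-cong (≈-trans (*-congˡ (ξs≈0 Fin.zero)) (zeroʳ _))
                    (linComb-vanishes n (cs ∘ Fin.suc) (ξs ∘ Fin.suc) w (ξs≈0 ∘ Fin.suc)))
            (+-identityʳ 0#)

  linComb-single : ∀ n cs ξs i w → (∀ j → j ≢ i → ξs j w ≈ 0#) → linComb 𝒜 n cs ξs w ≈ ι (cs i) *ᴬ ξs i w
  linComb-single (suc n) cs ξs Fin.zero    w others≈0 =
    ≈-trans (+-cong ≈-refl (linComb-vanishes n (cs ∘ Fin.suc) (ξs ∘ Fin.suc) w (λ j → others≈0 (Fin.suc j) λ ())))
            (+-identityʳ _)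
  linComb-single (suc n) cs ξs (Fin.suc i) w others≈0 =
    ≈-trans (+-cong (≈-trans (*-congˡ (others≈0 Fin.zero λ ())) (zeroʳ _))
                    (linComb-single n (cs ∘ Fin.suc) (ξs ∘ Fin.suc) i w
                                    (λ j j≢i → others≈0 (Fin.suc j) (j≢i ∘ FinP.suc-injective))))
            (+-identityˡ _)

  LinIndep-diagonal : Nonzero 𝒜 → ∀ {n} (hs : Fin n → Word → ℚ) (ws : Fin n → Word) →
    (∀ i j → j ≢ i → hs j (ws i) ≡ 0ℚ) → (∀ i → hs i (ws i) ≢ 0ℚ) → LinIndep 𝒜 n (λ i → ι ∘ hs i)
  LinIndep-diagonal 1≉0 {n} hs ws off-diagonal diagonal cs combination≈0 i =
    decidable-stable (cs i ℚP.≟ 0ℚ) λ csᵢ≢0 →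
      x#0y#0→xy#0 csᵢ≢0 (diagonal i) (ι≈0⇒≡0 1≉0 _ (begin
        ι (cs i * hs i (ws i))           ≈⟨ *-homo (cs i) (hs i (ws i)) ⟩
        ι (cs i) *ᴬ ι (hs i (ws i))      ≈⟨ linComb-single n cs (λ j → ι ∘ hs j) i (ws i) off-diagonal-ι ⟨
        linComb 𝒜 n cs (λ j → ι ∘ hs j) (ws i) ≈⟨ combination≈0 (ws i) ⟩
        0#                               ∎))
    where
    off-diagonal-ι : ∀ j → j ≢ i → ι (hs j (ws i)) ≈ 0#
    off-diagonal-ι j j≢i = ≈-trans (reflexive (cong ι (off-diagonal i j j≢i))) 0#-homo

mainTheorem5 : ∀ {c ℓ : Level} (𝒜 : QAlgebra c ℓ) →
    Nonzero 𝒜 → 𝔱-InfiniteDimensional 𝒜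
mainTheorem5 𝒜 1≉0 n =
  (λ i → QAlgebra.ι 𝒜 ∘ ξ (toℕ i)) ,
  (λ i → In𝔱-ι 𝒜 (η-IsInfCharℚ (+ suc (suc (toℕ i)))) (η-NonSingular (+ suc (suc (toℕ i))))) ,
  LinIndep-diagonal 𝒜 1≉0 (ξ ∘ toℕ) (τ ∘ toℕ)
    (λ i j j≢i → ξ-τ-off-diagonal (toℕ j) (toℕ i) (j≢i ∘ FinP.toℕ-injective))
    (ξ-τ-diagonal ∘ toℕ)
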